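{- Let $G$ be a finite connected graph and $r\in\mathbb N$. Then the group $\mathcal D_r$ of deck transformations of the $r$-local covering of $G$ is finitely presented.
   Context: Graphs may have loops and parallel edges and are viewed as 1-complexes. For a vertex $x_0$, a closed walk $W$ at $x_0$ stems from a cycle $O$ if $W=W_0QW_0^-$, where $W_0$ is a walk from $x_0$ to a vertex of $O$, $Q$ is a closed walk traversing each edge of $O$ exactly once, and $W_0^-$ is the reverse of $W_0$. $\pi_1^r(G,x_0)$ is the subgroup of $\pi_1(G,x_0)$ generated by the closed walks at $x_0$ stemming from cycles of length at most $r$; it is normal. The $r$-local covering $p_r:G_r\to G$ is the (connected) covering with characteristic subgroup $\pi_1^r(G,x_0)$. -}

module Defs where

open import Data.Nat using (ℕ; _≤_; _<_)
open import Data.Fin using (Fin)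
open import Data.Bool using (Bool; true; false; not; if_then_else_)
open import Data.Product using (Σ; ∃; _×_; _,_; proj₁; proj₂)
open import Data.List using (List; []; _∷_; _++_; map; reverse; length; concat)
open import Data.List.Relation.Unary.Unique.Propositional using (Unique)
open import Data.List.Membership.Propositional using (_∈_)
open import Relation.Binary.PropositionalEquality using (_≡_; refl; sym)
open import Relation.Binary.Construct.Closure.Equivalence using (EqClosure)

-- Finite graphs (loops and parallel edges allowed).
-- Vertices Fin nV, edges Fin nE; each edge e has a reference orientation
-- from src e to tgt e (a loop has src e ≡ tgt e).

record Graph : Set where
  field
    nV nE : ℕ
    src tgt : Fin nE → Fin nV

module _ (G : Graph) where
  open Graph G

  V E : Set
  V = Fin nV
  E = Fin nE

  -- darts = oriented edges; true = reference orientation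
  Dart : Set
  Dart = E × Bool

  dsrc dtgt : Dart → V
  dsrc (e , true)  = src e
  dsrc (e , false) = tgt e
  dtgt (e , true)  = tgt e
  dtgt (e , false) = src e

  dinv : Dart → Dart
  dinv (e , b) = (e , not b)

  IsWalk : V → V → List Dart → Set
  IsWalk x y []       = x ≡ y
  IsWalk x y (d ∷ ds) = dsrc d ≡ x × IsWalk (dtgt d) y ds

  Walk : V → V → Set
  Walk x y = Σ (List Dart) (IsWalk x y)

  rev : List Dart → List Dart
  rev ds = map dinv (reverse ds)

  data _⇝_ : List Dart → List Dart → Set where
    cancel : ∀ as d bs → (as ++ d ∷ dinv d ∷ bs) ⇝ (as ++ bs)

  _∼_ : List Dart → List Dart → Set
  _∼_ = EqClosure _⇝_

  Connected : Set
  Connected = ∀ (u v : V) → Walk u v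

  -- Q is a closed walk at v traversing each edge of a cycle O of length k
  -- exactly once (with 1 ≤ k ≤ r): k darts, pairwise distinct edges,
  -- pairwise distinct visited vertices.
  CycleTraversal : ℕ → V → List Dart → Set
  CycleTraversal r v qs =
    IsWalk v v qs × (0 < length qs) × (length qs ≤ r)
    × Unique (map proj₁ qs) × Unique (map dsrc qs)

  Stems : V → ℕ → List Dart → Set
  Stems x₀ r ws = Σ V λ v → Σ (List Dart) λ w₀ → Σ (List Dart) λ q →
    IsWalk x₀ v w₀ × CycleTraversal r v q × (ws ≡ w₀ ++ q ++ rev w₀)

  -- membership (of the homotopy class of a closed walk at x₀) in π₁ʳ(G,x₀):
  -- homotopic to a product of stemming walks and their inverses
  StemWalk : V → ℕ → Set
  StemWalk x₀ r = Σ (List Dart) (Stems x₀ r)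

  signed : ∀ {x₀ r} → Bool × StemWalk x₀ r → List Dart
  signed (b , ws , _) = if b then ws else rev ws

  InΠ₁ʳ : V → ℕ → List Dart → Set
  InΠ₁ʳ x₀ r c = Σ (List (Bool × StemWalk x₀ r)) λ gs → c ∼ concat (map signed gs)

  -- The r-local covering G_r → G, built as the covering with
  -- characteristic subgroup π₁ʳ(G,x₀): lifts of vertices / edges are
  -- classes of walks from x₀ modulo π₁ʳ.

  module Cover (x₀ : V) (r : ℕ) where

    LV : Set
    LV = Σ V λ v → Walk x₀ v

    LE : Set
    LE = Σ E λ e → Walk x₀ (src e)

    _≈V_ : LV → LV → Set
    (v , w , _) ≈V (v' , w' , _) = (v ≡ v') × InΠ₁ʳ x₀ r (w ++ rev w')

    _≈E_ : LE → LE → Set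
    (e , w , _) ≈E (e' , w' , _) = (e ≡ e') × InΠ₁ʳ x₀ r (w ++ rev w')

    lsrc : LE → LV
    lsrc (e , w , p) = (src e , w , p)

    snoc-walk : ∀ {x} (w : List Dart) (e : E) → IsWalk x (src e) w →
                IsWalk x (tgt e) (w ++ (e , true) ∷ [])
    snoc-walk [] e p = sym p , refl
    snoc-walk (d ∷ ds) e (q , p) = q , snoc-walk ds e p

    ltgt : LE → LV
    ltgt (e , w , p) = (tgt e , w ++ (e , true) ∷ [] , snoc-walk w e p)

    -- deck transformations: automorphisms of the graph G_r commuting with
    -- the covering projection p_r (given on representatives, respecting
    -- the equivalences, bijective on vertices and edges)
    record Deck : Set where
      field
        fV : LV → LV
        fE : LE → LE
        fV-cong : ∀ {x y} → x ≈V y → fV x ≈V fV y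
        fE-cong : ∀ {x y} → x ≈E y → fE x ≈E fE y
        fV-over : ∀ x → proj₁ (fV x) ≡ proj₁ x
        fE-over : ∀ x → proj₁ (fE x) ≡ proj₁ x
        fE-src : ∀ x → fV (lsrc x) ≈V lsrc (fE x)
        fE-tgt : ∀ x → fV (ltgt x) ≈V ltgt (fE x)
        gV : LV → LV
        gE : LE → LE
        fgV : ∀ x → fV (gV x) ≈V x
        gfV : ∀ x → gV (fV x) ≈V x
        fgE : ∀ x → fE (gE x) ≈E x
        gfE : ∀ x → gE (fE x) ≈E x
    open Deck public

    _≈D_ : Deck → Deck → Set
    f ≈D g = (∀ x → fV f x ≈V fV g x) × (∀ x → fE f x ≈E fE g x)


    IsComposite : Deck → Deck → Deck → Set
    IsComposite h f g = (∀ x → fV h x ≈V fV f (fV g x)) × (∀ x → fE h x ≈E fE f (fE g x))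

-- Group presentations ⟨ Fin n | rels ⟩: words in generators and inverses,
-- equal iff related by free cancellation and insertion/removal of relators.

Letter : ℕ → Set
Letter n = Fin n × Bool

linv : ∀ {n} → Letter n → Letter n
linv (i , b) = (i , not b)

data PStep {n : ℕ} (rels : List (List (Letter n))) : List (Letter n) → List (Letter n) → Set where
  cancel : ∀ as l bs → PStep rels (as ++ l ∷ linv l ∷ bs) (as ++ bs)
  relator : ∀ as ρ bs → ρ ∈ rels → PStep rels (as ++ ρ ++ bs) (as ++ bs)

_⊢_≈P_ : ∀ {n} → List (List (Letter n)) → List (Letter n) → List (Letter n) → Set
rels ⊢ u ≈P v = EqClosure (PStep rels) u v

DeckFinitelyPresented : (G : Graph) → V G → ℕ → Set
DeckFinitelyPresented G x₀ r =
  Σ ℕ λ n → Σ (List (List (Letter n))) λ rels → Σ (Deck → List (Letter n)) λ Φ →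
    (∀ f g → f ≈D g → rels ⊢ Φ f ≈P Φ g)
    × (∀ f g → rels ⊢ Φ f ≈P Φ g → f ≈D g)
    × (∀ w → Σ Deck λ f → rels ⊢ Φ f ≈P w)
    × (∀ h f g → IsComposite h f g → rels ⊢ Φ h ≈P (Φ f ++ Φ g))
  where open Cover G x₀ r

{-# OPTIONS --safe #-}
-- The deck group of p_r is π₁(G,x₀)/π₁ʳ(G,x₀). A deck transformation f is determined by the
-- lift [W_f] of x₀ it hits: it acts on every lift [W] as the left translation [W] ↦ [W_f W],
-- and every closed walk c at x₀ yields such a translation. Fixing walks τ_v from x₀ to each
-- vertex v, the darts generate π₁(G,x₀) via d ↦ τ_{src d} d τ_{tgt d}⁻¹, and the relators
-- d = τ_{src d} d τ_{tgt d}⁻¹ present it; passing to π₁ʳ adds the traversals of cycles of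
-- length ≤ r, since every generator of π₁ʳ is conjugate to one. Both families are finite.
module Submission where

open import Defs
open import Data.Bool using (Bool; true; false; not)
open import Data.Bool.Properties using (not-involutive)
open import Data.Empty using (⊥; ⊥-elim)
open import Data.Fin.Properties using (_≟_)
open import Data.List using (List; []; _∷_; _++_; [_]; map; reverse; length; concat; filter; allFin; cartesianProduct; cartesianProductWith)
open import Data.List.Membership.Propositional using (_∈_)
open import Data.List.Membership.Propositional.Properties using (∈-allFin; ∈-cartesianProduct⁺; ∈-cartesianProductWith⁺; ∈-filter⁺; ∈-filter⁻; ∈-map⁺; ∈-map⁻; ∈-++⁺ˡ; ∈-++⁺ʳ; ∈-++⁻)
open import Data.List.Properties using (++-monoid; ++-assoc; ++-identityʳ; map-++; reverse-++; unfold-reverse; concat-++)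
open import Data.List.Relation.Unary.Any using (here; there)
import Data.List.Relation.Unary.Unique.DecPropositional as UniqueDec
open import Data.List.Reverse using (Reverse; []; _∶_∶ʳ_; reverseView)
open import Data.Nat using (ℕ; zero; suc; _≤_; s≤s; _<?_; _≤?_)
open import Data.Product using (Σ; _×_; _,_; proj₁; proj₂)
open import Data.Sum using (inj₁; inj₂)
open import Relation.Binary.Construct.Closure.Equivalence using (gmap; gfold; isEquivalence; setoid; return)
import Relation.Binary.Construct.Closure.Equivalence as EqClosure
import Relation.Binary.Reasoning.Setoid as SetoidReasoning
open import Relation.Binary.PropositionalEquality using (_≡_; refl; sym; trans; cong; cong₂; subst; subst₂; module ≡-Reasoning)
open import Relation.Binary.Bundles using (Setoid)
open import Relation.Binary.Structures using (IsEquivalence)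
open import Relation.Nullary using (Dec; yes; no)
open import Relation.Nullary.Decidable using (_×-dec_)
open import Relation.Unary using (Decidable)
open import Tactic.MonoidSolver using (solve)

Word : ℕ → Set
Word n = List (Letter n)

module _ {n : ℕ} where

  infix 8 _⁻¹

  -- For a graph G, Dart G is Letter (nE G) and rev G coincides definitionally with _⁻¹.
  _⁻¹ : Word n → Word n
  w ⁻¹ = map linv (reverse w)

  linv-involutive : ∀ (l : Letter n) → linv (linv l) ≡ l
  linv-involutive (i , b) = cong (i ,_) (not-involutive b)

  ⁻¹-∷ : ∀ l w → (l ∷ w) ⁻¹ ≡ w ⁻¹ ++ [ linv l ]
  ⁻¹-∷ l w = trans (cong (map linv) (unfold-reverse l w)) (map-++ linv (reverse w) [ l ])

  ⁻¹-++ : ∀ u w → (u ++ w) ⁻¹ ≡ w ⁻¹ ++ u ⁻¹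
  ⁻¹-++ u w = trans (cong (map linv) (reverse-++ u w)) (map-++ linv (reverse w) (reverse u))

  ⁻¹-involutive : ∀ w → w ⁻¹ ⁻¹ ≡ w
  ⁻¹-involutive [] = refl
  ⁻¹-involutive (l ∷ w) = begin
      (l ∷ w) ⁻¹ ⁻¹              ≡⟨ cong _⁻¹ (⁻¹-∷ l w) ⟩
      (w ⁻¹ ++ [ linv l ]) ⁻¹    ≡⟨ ⁻¹-++ (w ⁻¹) [ linv l ] ⟩
      linv (linv l) ∷ w ⁻¹ ⁻¹    ≡⟨ cong₂ _∷_ (linv-involutive l) (⁻¹-involutive w) ⟩
      l ∷ w                      ∎
    where open ≡-Reasoning

module Presentation {n : ℕ} (rels : List (Word n)) where

  infix 4 _≈_
  _≈_ : Word n → Word n → Set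
  u ≈ v = rels ⊢ u ≈P v

  ≈-isEquivalence : IsEquivalence _≈_
  ≈-isEquivalence = isEquivalence (PStep rels)

  module Reasoning = SetoidReasoning (setoid (PStep rels))

  open IsEquivalence ≈-isEquivalence public using () renaming (refl to ≈-refl; sym to ≈-sym; trans to ≈-trans; reflexive to ≡⇒≈)

  cancel-≈ : ∀ as l bs → as ++ l ∷ linv l ∷ bs ≈ as ++ bs
  cancel-≈ as l bs = return (cancel as l bs)

  relator-≈ : ∀ {ρ} → ρ ∈ rels → ρ ≈ []
  relator-≈ {ρ} ρ∈rels = ≈-trans (≡⇒≈ (sym (++-identityʳ ρ))) (return (relator [] ρ [] ρ∈rels))

  ≈-congˡ : ∀ z {u v} → u ≈ v → z ++ u ≈ z ++ v
  ≈-congˡ z = gmap (z ++_) prepend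
    where
    prepend : ∀ {u v} → PStep rels u v → PStep rels (z ++ u) (z ++ v)
    prepend (cancel as l bs) = subst₂ (PStep rels) (++-assoc z as _) (++-assoc z as bs) (cancel (z ++ as) l bs)
    prepend (relator as ρ bs m) = subst₂ (PStep rels) (++-assoc z as _) (++-assoc z as bs) (relator (z ++ as) ρ bs m)

  ≈-congʳ : ∀ z {u v} → u ≈ v → u ++ z ≈ v ++ z
  ≈-congʳ z = gmap (_++ z) append
    where
    append : ∀ {u v} → PStep rels u v → PStep rels (u ++ z) (v ++ z)
    append (cancel as l bs) = subst₂ (PStep rels) (sym (++-assoc as (l ∷ linv l ∷ bs) z)) (sym (++-assoc as bs z)) (cancel as l (bs ++ z))
    append (relator as ρ bs m) = subst₂ (PStep rels) (trans (cong (as ++_) (sym (++-assoc ρ bs z))) (sym (++-assoc as (ρ ++ bs) z))) (sym (++-assoc as bs z)) (relator as ρ (bs ++ z) m)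

  ≈-cong : ∀ {u v u' v'} → u ≈ v → u' ≈ v' → u ++ u' ≈ v ++ v'
  ≈-cong {v = v} {u'} p q = ≈-trans (≈-congʳ u' p) (≈-congˡ v q)

  inverseʳ : ∀ w → w ++ w ⁻¹ ≈ []
  inverseʳ [] = ≈-refl
  inverseʳ (l ∷ w) = begin
      l ∷ w ++ (l ∷ w) ⁻¹            ≡⟨ cong (λ t → l ∷ w ++ t) (⁻¹-∷ l w) ⟩
      l ∷ w ++ w ⁻¹ ++ [ linv l ]    ≡⟨ cong (l ∷_) (sym (++-assoc w (w ⁻¹) _)) ⟩
      l ∷ (w ++ w ⁻¹) ++ [ linv l ]  ≈⟨ ≈-congˡ [ l ] (≈-congʳ [ linv l ] (inverseʳ w)) ⟩
      l ∷ linv l ∷ []                ≈⟨ cancel-≈ [] l [] ⟩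
      []                             ∎
    where open Reasoning

  inverseˡ : ∀ w → w ⁻¹ ++ w ≈ []
  inverseˡ w = subst (λ t → w ⁻¹ ++ t ≈ []) (⁻¹-involutive w) (inverseʳ (w ⁻¹))

  ≈-by-inverse : ∀ {u v} → u ++ v ⁻¹ ≈ [] → u ≈ v
  ≈-by-inverse {u} {v} p = begin
      u                  ≡⟨ ++-identityʳ u ⟨
      u ++ []            ≈⟨ ≈-congˡ u (inverseˡ v) ⟨
      u ++ v ⁻¹ ++ v     ≡⟨ ++-assoc u (v ⁻¹) v ⟨
      (u ++ v ⁻¹) ++ v   ≈⟨ ≈-congʳ v p ⟩
      v                  ∎
    where open Reasoning

  ⁻¹-≈[] : ∀ {w} → w ≈ [] → w ⁻¹ ≈ []
  ⁻¹-≈[] {w} p = begin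
      w ⁻¹              ≡⟨ ++-identityʳ (w ⁻¹) ⟨
      w ⁻¹ ++ []        ≈⟨ ≈-congˡ (w ⁻¹) p ⟨
      w ⁻¹ ++ w         ≈⟨ inverseˡ w ⟩
      []                ∎
    where open Reasoning

module FreeReduction (G : Graph) where

  infix 4 _≃_
  _≃_ : List (Dart G) → List (Dart G) → Set
  _≃_ = _∼_ G

  ≃-isEquivalence : IsEquivalence _≃_
  ≃-isEquivalence = isEquivalence (_⇝_ G)

  open IsEquivalence ≃-isEquivalence public using () renaming (refl to ≃-refl; sym to ≃-sym; trans to ≃-trans; reflexive to ≡⇒≃)

  module ≃-Reasoning = SetoidReasoning (setoid (_⇝_ G))

  ∼⇒≈P : ∀ {rels : List (Word (Graph.nE G))} {u v} → u ≃ v → rels ⊢ u ≈P v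
  ∼⇒≈P = EqClosure.map λ { (cancel as d bs) → cancel as d bs }

  private
    module Free = Presentation {Graph.nE G} []

    free⇒≃ : ∀ {u v} → [] ⊢ u ≈P v → u ≃ v
    free⇒≃ = EqClosure.map λ { (cancel as d bs) → cancel as d bs ; (relator as ρ bs ()) }

  cancel-≃ : ∀ as d bs → as ++ d ∷ dinv G d ∷ bs ≃ as ++ bs
  cancel-≃ as d bs = return (cancel as d bs)

  ≃-congˡ : ∀ z {u v} → u ≃ v → z ++ u ≃ z ++ v
  ≃-congˡ z p = free⇒≃ (Free.≈-congˡ z (∼⇒≈P p))

  ≃-congʳ : ∀ z {u v} → u ≃ v → u ++ z ≃ v ++ z
  ≃-congʳ z p = free⇒≃ (Free.≈-congʳ z (∼⇒≈P p))

  ≃-cong : ∀ {u v u' v'} → u ≃ v → u' ≃ v' → u ++ u' ≃ v ++ v'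
  ≃-cong p q = free⇒≃ (Free.≈-cong (∼⇒≈P p) (∼⇒≈P q))

  ≃-inverseʳ : ∀ w → w ++ w ⁻¹ ≃ []
  ≃-inverseʳ w = free⇒≃ (Free.inverseʳ w)

  ≃-inverseˡ : ∀ w → w ⁻¹ ++ w ≃ []
  ≃-inverseˡ w = free⇒≃ (Free.inverseˡ w)

  backtrack-⁻¹ : ∀ d → (d ∷ dinv G d ∷ []) ⁻¹ ≡ d ∷ dinv G d ∷ []
  backtrack-⁻¹ (e , true) = refl
  backtrack-⁻¹ (e , false) = refl

  ⁻¹-cong : ∀ {u v} → u ≃ v → u ⁻¹ ≃ v ⁻¹
  ⁻¹-cong = gfold ≃-isEquivalence _⁻¹ λ { (cancel as d bs) → reversed as d bs }
    where
    reversed : ∀ as d bs → (as ++ d ∷ dinv G d ∷ bs) ⁻¹ ≃ (as ++ bs) ⁻¹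
    reversed as d bs = begin
        (as ++ (d ∷ dinv G d ∷ []) ++ bs) ⁻¹          ≡⟨ ⁻¹-++ as _ ⟩
        ((d ∷ dinv G d ∷ []) ++ bs) ⁻¹ ++ as ⁻¹       ≡⟨ cong (_++ as ⁻¹) (⁻¹-++ (d ∷ dinv G d ∷ []) bs) ⟩
        (bs ⁻¹ ++ (d ∷ dinv G d ∷ []) ⁻¹) ++ as ⁻¹    ≡⟨ ++-assoc (bs ⁻¹) _ (as ⁻¹) ⟩
        bs ⁻¹ ++ (d ∷ dinv G d ∷ []) ⁻¹ ++ as ⁻¹      ≡⟨ cong (λ t → bs ⁻¹ ++ t ++ as ⁻¹) (backtrack-⁻¹ d) ⟩
        bs ⁻¹ ++ d ∷ dinv G d ∷ as ⁻¹                 ≈⟨ cancel-≃ (bs ⁻¹) d (as ⁻¹) ⟩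
        bs ⁻¹ ++ as ⁻¹                                ≡⟨ ⁻¹-++ as bs ⟨
        (as ++ bs) ⁻¹                                 ∎
      where open ≃-Reasoning

  dsrc-dinv : ∀ d → dsrc G (dinv G d) ≡ dtgt G d
  dsrc-dinv (e , true) = refl
  dsrc-dinv (e , false) = refl

  dtgt-dinv : ∀ d → dtgt G (dinv G d) ≡ dsrc G d
  dtgt-dinv (e , true) = refl
  dtgt-dinv (e , false) = refl

  isWalk-++ : ∀ {x y z} u {w} → IsWalk G x y u → IsWalk G y z w → IsWalk G x z (u ++ w)
  isWalk-++ [] refl q = q
  isWalk-++ (d ∷ u) (s , p) q = s , isWalk-++ u p q

  isWalk-++⁻ : ∀ {x z} u {w} → IsWalk G x z (u ++ w) → Σ (V G) λ y → IsWalk G x y u × IsWalk G y z w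
  isWalk-++⁻ {x} [] p = x , refl , p
  isWalk-++⁻ (d ∷ u) (s , p) with isWalk-++⁻ u p
  ... | y , p₁ , p₂ = y , (s , p₁) , p₂

  isWalk-⁻¹ : ∀ {x y} w → IsWalk G x y w → IsWalk G y x (w ⁻¹)
  isWalk-⁻¹ [] refl = refl
  isWalk-⁻¹ {x} {y} (d ∷ w) (s , p) = subst (IsWalk G y x) (sym (⁻¹-∷ d w))
    (isWalk-++ (w ⁻¹) (isWalk-⁻¹ w p) (dsrc-dinv d , trans (dtgt-dinv d) s))

  conjugate-++ : ∀ z u w → z ++ (u ++ w) ++ z ⁻¹ ≃ (z ++ u ++ z ⁻¹) ++ (z ++ w ++ z ⁻¹)
  conjugate-++ z u w = begin
      z ++ (u ++ w) ++ z ⁻¹                 ≡⟨ solve (++-monoid (Dart G)) ⟩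
      (z ++ u) ++ [] ++ w ++ z ⁻¹           ≈⟨ ≃-congˡ (z ++ u) (≃-congʳ (w ++ z ⁻¹) (≃-inverseˡ z)) ⟨
      (z ++ u) ++ (z ⁻¹ ++ z) ++ w ++ z ⁻¹  ≡⟨ solve (++-monoid (Dart G)) ⟩
      (z ++ u ++ z ⁻¹) ++ (z ++ w ++ z ⁻¹)  ∎
    where open ≃-Reasoning

  ∷ʳ-backtrack : ∀ w d → (w ++ [ d ]) ++ [ dinv G d ] ≃ w
  ∷ʳ-backtrack w d = begin
      (w ++ [ d ]) ++ [ dinv G d ]  ≡⟨ ++-assoc w [ d ] _ ⟩
      w ++ d ∷ dinv G d ∷ []        ≈⟨ cancel-≃ w d [] ⟩
      w ++ []                       ≡⟨ ++-identityʳ w ⟩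
      w                             ∎
    where open ≃-Reasoning

  ⁻¹-cancelˡ : ∀ c w → c ⁻¹ ++ c ++ w ≃ w
  ⁻¹-cancelˡ c w = ≃-trans (≡⇒≃ (sym (++-assoc (c ⁻¹) c w))) (≃-congʳ w (≃-inverseˡ c))

  ⁻¹-cancelʳ : ∀ c w → c ++ c ⁻¹ ++ w ≃ w
  ⁻¹-cancelʳ c w = ≃-trans (≡⇒≃ (sym (++-assoc c (c ⁻¹) w))) (≃-congʳ w (≃-inverseʳ c))

  backtrack-conj : ∀ a d b → (a ++ d ∷ b ⁻¹) ++ (b ++ dinv G d ∷ a ⁻¹) ≃ []
  backtrack-conj a d b = begin
      (a ++ d ∷ b ⁻¹) ++ (b ++ dinv G d ∷ a ⁻¹)       ≡⟨ solve (++-monoid (Dart G)) ⟩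
      (a ++ [ d ]) ++ (b ⁻¹ ++ b) ++ dinv G d ∷ a ⁻¹  ≈⟨ ≃-congˡ (a ++ [ d ]) (≃-congʳ _ (≃-inverseˡ b)) ⟩
      (a ++ [ d ]) ++ dinv G d ∷ a ⁻¹                 ≡⟨ ++-assoc a [ d ] _ ⟩
      a ++ d ∷ dinv G d ∷ a ⁻¹                        ≈⟨ cancel-≃ a d (a ⁻¹) ⟩
      a ++ a ⁻¹                                       ≈⟨ ≃-inverseʳ a ⟩
      []                                              ∎
    where open ≃-Reasoning

module LocalSubgroup (G : Graph) (x₀ : V G) (r : ℕ) where

  open FreeReduction G

  Π₁ʳ : List (Dart G) → Set
  Π₁ʳ = InΠ₁ʳ G x₀ r

  Factor : Set
  Factor = Bool × StemWalk G x₀ r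

  product : List Factor → List (Dart G)
  product gs = concat (map (signed G) gs)

  product-++ : ∀ gs hs → product (gs ++ hs) ≡ product gs ++ product hs
  product-++ gs hs = trans (cong concat (map-++ (signed G) gs hs)) (sym (concat-++ (map (signed G) gs) _))

  Π₁ʳ-resp-≃ : ∀ {u v} → u ≃ v → Π₁ʳ v → Π₁ʳ u
  Π₁ʳ-resp-≃ p (gs , q) = gs , ≃-trans p q

  Π₁ʳ-[] : Π₁ʳ []
  Π₁ʳ-[] = [] , ≃-refl

  Π₁ʳ-stem : (s : StemWalk G x₀ r) → Π₁ʳ (proj₁ s)
  Π₁ʳ-stem s = (true , s) ∷ [] , ≡⇒≃ (sym (++-identityʳ _))

  Π₁ʳ-++ : ∀ {u w} → Π₁ʳ u → Π₁ʳ w → Π₁ʳ (u ++ w)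
  Π₁ʳ-++ (gs , p) (hs , q) = gs ++ hs , ≃-trans (≃-cong p q) (≡⇒≃ (sym (product-++ gs hs)))

  invertFactors : List Factor → List Factor
  invertFactors [] = []
  invertFactors ((b , s) ∷ gs) = invertFactors gs ++ [ (not b , s) ]

  signed-⁻¹ : ∀ b (s : StemWalk G x₀ r) → signed G (b , s) ⁻¹ ≡ signed G (not b , s)
  signed-⁻¹ true s = refl
  signed-⁻¹ false (w , _) = ⁻¹-involutive w

  product-⁻¹ : ∀ gs → product gs ⁻¹ ≡ product (invertFactors gs)
  product-⁻¹ [] = refl
  product-⁻¹ ((b , s) ∷ gs) = begin
      (signed G (b , s) ++ product gs) ⁻¹                     ≡⟨ ⁻¹-++ (signed G (b , s)) (product gs) ⟩
      product gs ⁻¹ ++ signed G (b , s) ⁻¹                    ≡⟨ cong₂ _++_ (product-⁻¹ gs) (signed-⁻¹ b s) ⟩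
      product (invertFactors gs) ++ signed G (not b , s)      ≡⟨ cong (product (invertFactors gs) ++_) (++-identityʳ _) ⟨
      product (invertFactors gs) ++ product [ (not b , s) ]   ≡⟨ product-++ (invertFactors gs) _ ⟨
      product (invertFactors gs ++ [ (not b , s) ])           ∎
    where open ≡-Reasoning

  Π₁ʳ-⁻¹ : ∀ {w} → Π₁ʳ w → Π₁ʳ (w ⁻¹)
  Π₁ʳ-⁻¹ (gs , p) = invertFactors gs , ≃-trans (⁻¹-cong p) (≡⇒≃ (product-⁻¹ gs))

  module _ {z : List (Dart G)} (z-closed : IsWalk G x₀ x₀ z) where

    conjStem : StemWalk G x₀ r → StemWalk G x₀ r
    conjStem (w , v , w₀ , q , w₀-walk , cycle , w≡) =
      z ++ w ++ z ⁻¹ , v , z ++ w₀ , q , isWalk-++ z z-closed w₀-walk , cycle , conj≡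
      where
      conj≡ : z ++ w ++ z ⁻¹ ≡ (z ++ w₀) ++ q ++ (z ++ w₀) ⁻¹
      conj≡ = begin
        z ++ w ++ z ⁻¹                     ≡⟨ cong (λ t → z ++ t ++ z ⁻¹) w≡ ⟩
        z ++ (w₀ ++ q ++ w₀ ⁻¹) ++ z ⁻¹    ≡⟨ solve (++-monoid (Dart G)) ⟩
        (z ++ w₀) ++ q ++ w₀ ⁻¹ ++ z ⁻¹    ≡⟨ cong (λ t → (z ++ w₀) ++ q ++ t) (⁻¹-++ z w₀) ⟨
        (z ++ w₀) ++ q ++ (z ++ w₀) ⁻¹     ∎
        where open ≡-Reasoning

    conjFactor : Factor → Factor
    conjFactor (b , s) = b , conjStem s

    signed-conj : ∀ g → signed G (conjFactor g) ≡ z ++ signed G g ++ z ⁻¹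
    signed-conj (true , s) = refl
    signed-conj (false , w , _) = begin
        (z ++ w ++ z ⁻¹) ⁻¹          ≡⟨ ⁻¹-++ z (w ++ z ⁻¹) ⟩
        (w ++ z ⁻¹) ⁻¹ ++ z ⁻¹       ≡⟨ cong (_++ z ⁻¹) (⁻¹-++ w (z ⁻¹)) ⟩
        (z ⁻¹ ⁻¹ ++ w ⁻¹) ++ z ⁻¹    ≡⟨ cong (λ t → (t ++ w ⁻¹) ++ z ⁻¹) (⁻¹-involutive z) ⟩
        (z ++ w ⁻¹) ++ z ⁻¹          ≡⟨ ++-assoc z (w ⁻¹) (z ⁻¹) ⟩
        z ++ w ⁻¹ ++ z ⁻¹            ∎
      where open ≡-Reasoning

    product-conj : ∀ gs → z ++ product gs ++ z ⁻¹ ≃ product (map conjFactor gs)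
    product-conj [] = ≃-inverseʳ z
    product-conj (g ∷ gs) = ≃-trans (conjugate-++ z (signed G g) (product gs))
      (≃-cong (≡⇒≃ (sym (signed-conj g))) (product-conj gs))

    Π₁ʳ-conj : ∀ {w} → Π₁ʳ w → Π₁ʳ (z ++ w ++ z ⁻¹)
    Π₁ʳ-conj (gs , p) = map conjFactor gs , ≃-trans (≃-congˡ z (≃-congʳ (z ⁻¹) p)) (product-conj gs)

  infix 4 _≋_

  -- Walks from x₀ that lift to the same vertex of G_r; a record rather than a synonym for
  -- Π₁ʳ (u ++ v ⁻¹), so that u and v stay inferable.
  record _≋_ (u v : List (Dart G)) : Set where
    constructor coset
    field uncoset : Π₁ʳ (u ++ v ⁻¹)
  open _≋_ public

  ≃⇒≋ : ∀ {u v} → u ≃ v → u ≋ v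
  ≃⇒≋ {v = v} p = coset (Π₁ʳ-resp-≃ (≃-trans (≃-congʳ (v ⁻¹) p) (≃-inverseʳ v)) Π₁ʳ-[])

  ≡⇒≋ : ∀ {u v} → u ≡ v → u ≋ v
  ≡⇒≋ p = ≃⇒≋ (≡⇒≃ p)

  ≋-sym : ∀ {u v} → u ≋ v → v ≋ u
  ≋-sym {u} {v} (coset p) = coset (subst Π₁ʳ inverse≡ (Π₁ʳ-⁻¹ p))
    where
    inverse≡ : (u ++ v ⁻¹) ⁻¹ ≡ v ++ u ⁻¹
    inverse≡ = trans (⁻¹-++ u (v ⁻¹)) (cong (_++ u ⁻¹) (⁻¹-involutive v))

  ≋-trans : ∀ {u v w} → u ≋ v → v ≋ w → u ≋ w
  ≋-trans {u} {v} {w} (coset p) (coset q) = coset (Π₁ʳ-resp-≃ (≃-sym telescope) (Π₁ʳ-++ p q))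
    where
    telescope : (u ++ v ⁻¹) ++ (v ++ w ⁻¹) ≃ u ++ w ⁻¹
    telescope = begin
      (u ++ v ⁻¹) ++ (v ++ w ⁻¹)   ≡⟨ solve (++-monoid (Dart G)) ⟩
      u ++ (v ⁻¹ ++ v) ++ w ⁻¹     ≈⟨ ≃-congˡ u (≃-congʳ (w ⁻¹) (≃-inverseˡ v)) ⟩
      u ++ w ⁻¹                    ∎
      where open ≃-Reasoning

  ≋-isEquivalence : IsEquivalence _≋_
  ≋-isEquivalence = record { refl = ≡⇒≋ refl ; sym = ≋-sym ; trans = ≋-trans }

  ≋-setoid : Setoid _ _
  ≋-setoid = record { isEquivalence = ≋-isEquivalence }

  module ≋-Reasoning = SetoidReasoning ≋-setoid

  ≋-congʳ : ∀ z {u v} → u ≋ v → u ++ z ≋ v ++ z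
  ≋-congʳ z {u} {v} (coset p) = coset (Π₁ʳ-resp-≃ cancelled p)
    where
    cancelled : (u ++ z) ++ (v ++ z) ⁻¹ ≃ u ++ v ⁻¹
    cancelled = begin
      (u ++ z) ++ (v ++ z) ⁻¹      ≡⟨ cong ((u ++ z) ++_) (⁻¹-++ v z) ⟩
      (u ++ z) ++ z ⁻¹ ++ v ⁻¹     ≡⟨ solve (++-monoid (Dart G)) ⟩
      u ++ (z ++ z ⁻¹) ++ v ⁻¹     ≈⟨ ≃-congˡ u (≃-congʳ (v ⁻¹) (≃-inverseʳ z)) ⟩
      u ++ v ⁻¹                    ∎
      where open ≃-Reasoning

  ≋-congˡ : ∀ {z} → IsWalk G x₀ x₀ z → ∀ {u v} → u ≋ v → z ++ u ≋ z ++ v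
  ≋-congˡ {z} z-closed {u} {v} (coset p) = coset (subst Π₁ʳ conjugate≡ (Π₁ʳ-conj z-closed p))
    where
    conjugate≡ : z ++ (u ++ v ⁻¹) ++ z ⁻¹ ≡ (z ++ u) ++ (z ++ v) ⁻¹
    conjugate≡ = begin
      z ++ (u ++ v ⁻¹) ++ z ⁻¹     ≡⟨ solve (++-monoid (Dart G)) ⟩
      (z ++ u) ++ v ⁻¹ ++ z ⁻¹     ≡⟨ cong ((z ++ u) ++_) (⁻¹-++ z v) ⟨
      (z ++ u) ++ (z ++ v) ⁻¹      ∎
      where open ≡-Reasoning

module DeckTransformations (G : Graph) (x₀ : V G) (r : ℕ) where

  open FreeReduction G
  open LocalSubgroup G x₀ r
  open Cover G x₀ r

  word : LV → List (Dart G)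
  word (_ , w , _) = w

  ≈V⇒≋ : ∀ x y → x ≈V y → word x ≋ word y
  ≈V⇒≋ _ _ (_ , p) = coset p

  ≈V-irrelevant : ∀ {v w} (p q : IsWalk G x₀ v w) → (v , w , p) ≈V (v , w , q)
  ≈V-irrelevant {w = w} _ _ = refl , uncoset (≡⇒≋ {w} refl)

  baseLift : LV
  baseLift = x₀ , [] , refl

  deckWord : Deck → List (Dart G)
  deckWord f = word (fV f baseLift)

  deckWord-closed : ∀ f → IsWalk G x₀ x₀ (deckWord f)
  deckWord-closed f = subst (λ v → IsWalk G x₀ v (deckWord f)) (fV-over f baseLift) (proj₂ (proj₂ (fV f baseLift)))

  module _ (f : Deck) where

    TranslatesLift : LV → Set
    TranslatesLift x = word (fV f x) ≋ deckWord f ++ word x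

    translatesLift-resp-≈V : ∀ {x y} → x ≈V y → TranslatesLift x → TranslatesLift y
    translatesLift-resp-≈V {x} {y} x≈y fx≋ = begin
        word (fV f y)          ≈⟨ ≈V⇒≋ (fV f x) (fV f y) (fV-cong f x≈y) ⟨
        word (fV f x)          ≈⟨ fx≋ ⟩
        deckWord f ++ word x   ≈⟨ ≋-congˡ (deckWord-closed f) (≈V⇒≋ x y x≈y) ⟩
        deckWord f ++ word y   ∎
      where open ≋-Reasoning

    fV-ltgt : ∀ x → word (fV f (ltgt x)) ≋ word (fV f (lsrc x)) ++ [ (proj₁ x , true) ]
    fV-ltgt x = begin
        word (fV f (ltgt x))                                ≈⟨ ≈V⇒≋ (fV f (ltgt x)) (ltgt (fE f x)) (fE-tgt f x) ⟩
        word (lsrc (fE f x)) ++ [ (proj₁ (fE f x) , true) ] ≡⟨ cong (λ e → word (lsrc (fE f x)) ++ [ (e , true) ]) (fE-over f x) ⟩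
        word (lsrc (fE f x)) ++ [ (proj₁ x , true) ]        ≈⟨ ≋-congʳ _ (≈V⇒≋ (fV f (lsrc x)) (lsrc (fE f x)) (fE-src f x)) ⟨
        word (fV f (lsrc x)) ++ [ (proj₁ x , true) ]        ∎
      where open ≋-Reasoning

    translatesLift-ltgt : ∀ x → TranslatesLift (lsrc x) → TranslatesLift (ltgt x)
    translatesLift-ltgt x@(e , w , _) src≋ = begin
        word (fV f (ltgt x))                        ≈⟨ fV-ltgt x ⟩
        word (fV f (lsrc x)) ++ [ (e , true) ]      ≈⟨ ≋-congʳ _ src≋ ⟩
        (deckWord f ++ w) ++ [ (e , true) ]         ≡⟨ ++-assoc (deckWord f) w _ ⟩
        deckWord f ++ w ++ [ (e , true) ]           ∎
      where open ≋-Reasoning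

    translatesLift-lsrc : ∀ x → TranslatesLift (ltgt x) → TranslatesLift (lsrc x)
    translatesLift-lsrc x@(e , w , _) tgt≋ = begin
        word (fV f (lsrc x))                                         ≈⟨ ≃⇒≋ (∷ʳ-backtrack _ (e , true)) ⟨
        (word (fV f (lsrc x)) ++ [ (e , true) ]) ++ [ (e , false) ]  ≈⟨ ≋-congʳ _ (fV-ltgt x) ⟨
        word (fV f (ltgt x)) ++ [ (e , false) ]                      ≈⟨ ≋-congʳ _ tgt≋ ⟩
        (deckWord f ++ w ++ [ (e , true) ]) ++ [ (e , false) ]       ≡⟨ cong (_++ [ (e , false) ]) (++-assoc (deckWord f) w _) ⟨
        ((deckWord f ++ w) ++ [ (e , true) ]) ++ [ (e , false) ]     ≈⟨ ≃⇒≋ (∷ʳ-backtrack (deckWord f ++ w) (e , true)) ⟩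
        deckWord f ++ w                                              ∎
      where open ≋-Reasoning

    translatesLift : ∀ x → TranslatesLift x
    translatesLift (v , w , p) = along (reverseView w) p
      where
      along : ∀ {v w} → Reverse w → (p : IsWalk G x₀ v w) → TranslatesLift (v , w , p)
      along [] refl = ≡⇒≋ (sym (++-identityʳ (deckWord f)))
      along (pre ∶ view ∶ʳ d) p with isWalk-++⁻ pre p
      along (pre ∶ view ∶ʳ (e , true)) p | _ , p₁ , refl , refl =
        translatesLift-resp-≈V (≈V-irrelevant (snoc-walk pre e p₁) p) (translatesLift-ltgt (e , pre , p₁) (along view p₁))
      along (pre ∶ view ∶ʳ (e , false)) p | _ , p₁ , refl , refl =
        translatesLift-lsrc (e , pre ++ [ (e , false) ] , p)
          (translatesLift-resp-≈V (refl , uncoset (≋-sym (≃⇒≋ (∷ʳ-backtrack pre (e , false))))) (along view p₁))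

  ≈D⇒deckWord-≋ : ∀ f g → f ≈D g → deckWord f ≋ deckWord g
  ≈D⇒deckWord-≋ f g (f≈g , _) = ≈V⇒≋ (fV f baseLift) (fV g baseLift) (f≈g baseLift)

  deckWord-≋⇒≈D : ∀ f g → deckWord f ≋ deckWord g → f ≈D g
  deckWord-≋⇒≈D f g f≋g = onVertices , onEdges
    where
    onVertices : ∀ x → fV f x ≈V fV g x
    onVertices x = trans (fV-over f x) (sym (fV-over g x)) , uncoset (begin
        word (fV f x)          ≈⟨ translatesLift f x ⟩
        deckWord f ++ word x   ≈⟨ ≋-congʳ (word x) f≋g ⟩
        deckWord g ++ word x   ≈⟨ translatesLift g x ⟨
        word (fV g x)          ∎)
      where open ≋-Reasoning

    onEdges : ∀ x → fE f x ≈E fE g x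
    onEdges x = trans (fE-over f x) (sym (fE-over g x)) , uncoset (begin
        word (lsrc (fE f x))   ≈⟨ ≈V⇒≋ (fV f (lsrc x)) (lsrc (fE f x)) (fE-src f x) ⟨
        word (fV f (lsrc x))   ≈⟨ coset (proj₂ (onVertices (lsrc x))) ⟩
        word (fV g (lsrc x))   ≈⟨ ≈V⇒≋ (fV g (lsrc x)) (lsrc (fE g x)) (fE-src g x) ⟩
        word (lsrc (fE g x))   ∎)
      where open ≋-Reasoning

  deckWord-composite : ∀ h f g → IsComposite h f g → deckWord h ≋ deckWord f ++ deckWord g
  deckWord-composite h f g (h≈fg , _) = ≋-trans
    (≈V⇒≋ (fV h baseLift) (fV f (fV g baseLift)) (h≈fg baseLift)) (translatesLift f (fV g baseLift))

  module _ {c : List (Dart G)} (c-closed : IsWalk G x₀ x₀ c) where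

    translateV : LV → LV
    translateV (v , w , p) = v , c ++ w , isWalk-++ c c-closed p

    translateE : LE → LE
    translateE (e , w , p) = e , c ++ w , isWalk-++ c c-closed p

  translation : ∀ {c} → IsWalk G x₀ x₀ c → Deck
  translation {c} c-closed = record
    { fV = translateV c-closed
    ; fE = translateE c-closed
    ; fV-cong = λ { (v≡ , p) → v≡ , uncoset (≋-congˡ c-closed (coset p)) }
    ; fE-cong = λ { (e≡ , p) → e≡ , uncoset (≋-congˡ c-closed (coset p)) }
    ; fV-over = λ _ → refl
    ; fE-over = λ _ → refl
    ; fE-src = λ { (_ , w , _) → refl , uncoset (≡⇒≋ {c ++ w} refl) }
    ; fE-tgt = λ { (_ , w , _) → refl , uncoset (≡⇒≋ (sym (++-assoc c w _))) }
    ; gV = translateV c⁻¹-closed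
    ; gE = translateE c⁻¹-closed
    ; fgV = λ { (_ , w , _) → refl , uncoset (≃⇒≋ (⁻¹-cancelʳ c w)) }
    ; gfV = λ { (_ , w , _) → refl , uncoset (≃⇒≋ (⁻¹-cancelˡ c w)) }
    ; fgE = λ { (_ , w , _) → refl , uncoset (≃⇒≋ (⁻¹-cancelʳ c w)) }
    ; gfE = λ { (_ , w , _) → refl , uncoset (≃⇒≋ (⁻¹-cancelˡ c w)) }
    }
    where
    c⁻¹-closed : IsWalk G x₀ x₀ (c ⁻¹)
    c⁻¹-closed = isWalk-⁻¹ c c-closed

  deckWord-translation : ∀ {c} (c-closed : IsWalk G x₀ x₀ c) → deckWord (translation c-closed) ≡ c
  deckWord-translation {c} _ = ++-identityʳ c

module SpanningWalks (G : Graph) (connected : Connected G) (x₀ : V G) where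

  open FreeReduction G

  spanningWalk : (v : V G) → Walk G x₀ v
  spanningWalk v with v ≟ x₀
  ... | yes refl = [] , refl
  ... | no _ = connected x₀ v

  spine : V G → List (Dart G)
  spine v = proj₁ (spanningWalk v)

  spine-isWalk : ∀ v → IsWalk G x₀ v (spine v)
  spine-isWalk v = proj₂ (spanningWalk v)

  spine-x₀ : spine x₀ ≡ []
  spine-x₀ with x₀ ≟ x₀
  ... | yes refl = refl
  ... | no x₀≢x₀ = ⊥-elim (x₀≢x₀ refl)

  dartLoop : Dart G → List (Dart G)
  dartLoop d = spine (dsrc G d) ++ d ∷ spine (dtgt G d) ⁻¹

  dartLoop-closed : ∀ d → IsWalk G x₀ x₀ (dartLoop d)
  dartLoop-closed d = isWalk-++ (spine (dsrc G d)) (spine-isWalk _) (refl , isWalk-⁻¹ (spine (dtgt G d)) (spine-isWalk _))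

  dartLoop-inverse : ∀ d → dartLoop d ++ dartLoop (dinv G d) ≃ []
  dartLoop-inverse (e , true) = backtrack-conj (spine (Graph.src G e)) (e , true) (spine (Graph.tgt G e))
  dartLoop-inverse (e , false) = backtrack-conj (spine (Graph.tgt G e)) (e , false) (spine (Graph.src G e))

  viaSpine : List (Dart G) → List (Dart G)
  viaSpine [] = []
  viaSpine (d ∷ w) = dartLoop d ++ viaSpine w

  viaSpine-closed : ∀ w → IsWalk G x₀ x₀ (viaSpine w)
  viaSpine-closed [] = refl
  viaSpine-closed (d ∷ w) = isWalk-++ (dartLoop d) (dartLoop-closed d) (viaSpine-closed w)

  viaSpine-++ : ∀ u w → viaSpine (u ++ w) ≡ viaSpine u ++ viaSpine w
  viaSpine-++ [] w = refl
  viaSpine-++ (d ∷ u) w = trans (cong (dartLoop d ++_) (viaSpine-++ u w)) (sym (++-assoc (dartLoop d) (viaSpine u) (viaSpine w)))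

  -- The spines between consecutive darts cancel.
  viaSpine-telescopes : ∀ {x y} w → IsWalk G x y w → viaSpine w ≃ spine x ++ w ++ spine y ⁻¹
  viaSpine-telescopes {x} [] refl = ≃-sym (≃-inverseʳ (spine x))
  viaSpine-telescopes {y = y} (d ∷ w) (refl , p) = begin
      dartLoop d ++ viaSpine w                                        ≈⟨ ≃-congˡ (dartLoop d) (viaSpine-telescopes w p) ⟩
      dartLoop d ++ spine (dtgt G d) ++ w ++ spine y ⁻¹               ≡⟨ solve (++-monoid (Dart G)) ⟩
      (spine (dsrc G d) ++ [ d ]) ++ (spine (dtgt G d) ⁻¹ ++ spine (dtgt G d)) ++ w ++ spine y ⁻¹
                                                                      ≈⟨ ≃-congˡ (spine (dsrc G d) ++ [ d ]) (≃-congʳ (w ++ spine y ⁻¹) (≃-inverseˡ (spine (dtgt G d)))) ⟩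
      (spine (dsrc G d) ++ [ d ]) ++ w ++ spine y ⁻¹                  ≡⟨ ++-assoc (spine (dsrc G d)) [ d ] _ ⟩
      spine (dsrc G d) ++ d ∷ w ++ spine y ⁻¹                         ∎
    where open ≃-Reasoning

  viaSpine-≃ : ∀ {w} → IsWalk G x₀ x₀ w → viaSpine w ≃ w
  viaSpine-≃ {w} p = ≃-trans (viaSpine-telescopes w p) (≡⇒≃ (begin
      spine x₀ ++ w ++ spine x₀ ⁻¹   ≡⟨ cong (λ s → s ++ w ++ s ⁻¹) spine-x₀ ⟩
      w ++ []                        ≡⟨ ++-identityʳ w ⟩
      w                              ∎))
    where open ≡-Reasoning

module ShortCycles (G : Graph) (r : ℕ) where

  allDarts : List (Dart G)
  allDarts = cartesianProduct (allFin (Graph.nE G)) (true ∷ false ∷ [])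

  ∈-allDarts : ∀ d → d ∈ allDarts
  ∈-allDarts (e , true) = ∈-cartesianProduct⁺ (∈-allFin e) (here refl)
  ∈-allDarts (e , false) = ∈-cartesianProduct⁺ (∈-allFin e) (there (here refl))

  wordsUpTo : ℕ → List (List (Dart G))
  wordsUpTo zero = [] ∷ []
  wordsUpTo (suc k) = [] ∷ cartesianProductWith _∷_ allDarts (wordsUpTo k)

  ∈-wordsUpTo : ∀ k q → length q ≤ k → q ∈ wordsUpTo k
  ∈-wordsUpTo zero [] _ = here refl
  ∈-wordsUpTo (suc k) [] _ = here refl
  ∈-wordsUpTo (suc k) (d ∷ q) (s≤s q≤k) = there (∈-cartesianProductWith⁺ _∷_ (∈-allDarts d) (∈-wordsUpTo k q q≤k))

  isWalk? : ∀ x y w → Dec (IsWalk G x y w)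
  isWalk? x y [] = x ≟ y
  isWalk? x y (d ∷ w) = (dsrc G d ≟ x) ×-dec isWalk? (dtgt G d) y w

  -- The base vertex of a cycle traversal is the source of its first dart.
  IsCycleWord : List (Dart G) → Set
  IsCycleWord [] = ⊥
  IsCycleWord (d ∷ q) = CycleTraversal G r (dsrc G d) (d ∷ q)

  isCycleWord? : Decidable IsCycleWord
  isCycleWord? [] = no λ ()
  isCycleWord? (d ∷ q) = isWalk? _ _ (d ∷ q) ×-dec (0 <? length (d ∷ q)) ×-dec (length (d ∷ q) ≤? r)
    ×-dec UniqueDec.unique? _≟_ (map proj₁ (d ∷ q)) ×-dec UniqueDec.unique? _≟_ (map (dsrc G) (d ∷ q))

  cycleWords : List (List (Dart G))
  cycleWords = filter isCycleWord? (wordsUpTo r)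

  ∈-cycleWords : ∀ {v q} → CycleTraversal G r v q → q ∈ cycleWords
  ∈-cycleWords {q = []} (_ , () , _)
  ∈-cycleWords {q = d ∷ q} cycle@((refl , _) , _ , q≤r , _) = ∈-filter⁺ isCycleWord? (∈-wordsUpTo r (d ∷ q) q≤r) cycle

  cycleWords-traversal : ∀ {q} → q ∈ cycleWords → Σ (V G) λ v → CycleTraversal G r v q
  cycleWords-traversal {q} q∈ with q | proj₂ (∈-filter⁻ isCycleWord? {xs = wordsUpTo r} q∈)
  ... | d ∷ _ | cycle = dsrc G d , cycle

module DeckPresentation (G : Graph) (connected : Connected G) (x₀ : V G) (r : ℕ) where

  open FreeReduction G
  open LocalSubgroup G x₀ r
  open DeckTransformations G x₀ r
  open SpanningWalks G connected x₀
  open ShortCycles G r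

  dartRelator : Dart G → List (Dart G)
  dartRelator d = d ∷ dartLoop d ⁻¹

  relators : List (List (Dart G))
  relators = map dartRelator allDarts ++ cycleWords

  open Presentation relators

  Π₁ʳ⇒≈[] : ∀ {w} → Π₁ʳ w → w ≈ []
  Π₁ʳ⇒≈[] (gs , w≃) = ≈-trans (∼⇒≈P w≃) (product-≈[] gs)
    where
    stem-≈[] : (s : StemWalk G x₀ r) → proj₁ s ≈ []
    stem-≈[] (w , _ , w₀ , q , _ , cycle , refl) = begin
        w₀ ++ q ++ w₀ ⁻¹   ≈⟨ ≈-congˡ w₀ (≈-congʳ (w₀ ⁻¹) (relator-≈ (∈-++⁺ʳ _ (∈-cycleWords cycle)))) ⟩
        w₀ ++ w₀ ⁻¹        ≈⟨ inverseʳ w₀ ⟩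
        []                 ∎
      where open Reasoning

    product-≈[] : ∀ gs → product gs ≈ []
    product-≈[] [] = ≈-refl
    product-≈[] ((true , s) ∷ gs) = ≈-cong (stem-≈[] s) (product-≈[] gs)
    product-≈[] ((false , s) ∷ gs) = ≈-cong (⁻¹-≈[] (stem-≈[] s)) (product-≈[] gs)

  ≋⇒≈ : ∀ {u v} → u ≋ v → u ≈ v
  ≋⇒≈ (coset p) = ≈-by-inverse (Π₁ʳ⇒≈[] p)

  viaSpine-≈ : ∀ w → viaSpine w ≈ w
  viaSpine-≈ [] = ≈-refl
  viaSpine-≈ (d ∷ w) = ≈-cong {v = [ d ]} dartLoop-≈ (viaSpine-≈ w)
    where
    dartLoop-≈ : dartLoop d ≈ [ d ]
    dartLoop-≈ = ≈-sym (≈-by-inverse (relator-≈ (∈-++⁺ˡ (∈-map⁺ dartRelator (∈-allDarts d)))))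

  viaSpine-relator : ∀ {ρ} → ρ ∈ relators → viaSpine ρ ≋ []
  viaSpine-relator ρ∈ with ∈-++⁻ (map dartRelator allDarts) ρ∈
  ... | inj₁ ρ∈dartRelators with ∈-map⁻ dartRelator ρ∈dartRelators
  ...   | d , _ , refl = ≃⇒≋ (begin
          dartLoop d ++ viaSpine (dartLoop d ⁻¹)   ≈⟨ ≃-congˡ (dartLoop d) (viaSpine-≃ (isWalk-⁻¹ _ (dartLoop-closed d))) ⟩
          dartLoop d ++ dartLoop d ⁻¹              ≈⟨ ≃-inverseʳ (dartLoop d) ⟩
          []                                       ∎)
    where open ≃-Reasoning
  viaSpine-relator {ρ} ρ∈ | inj₂ ρ∈cycleWords with cycleWords-traversal ρ∈cycleWords
  ... | v , cycle = coset (Π₁ʳ-resp-≃ (≃-trans (≡⇒≃ (++-identityʳ _)) (viaSpine-telescopes ρ (proj₁ cycle)))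
                      (Π₁ʳ-stem (_ , v , spine v , ρ , spine-isWalk v , cycle , refl)))

  ≈⇒viaSpine-≋ : ∀ {u v} → u ≈ v → viaSpine u ≋ viaSpine v
  ≈⇒viaSpine-≋ = gfold ≋-isEquivalence viaSpine step
    where
    step : ∀ {u v} → PStep relators u v → viaSpine u ≋ viaSpine v
    step (cancel as l bs) = ≃⇒≋ (begin
        viaSpine (as ++ l ∷ linv l ∷ bs)                                  ≡⟨ viaSpine-++ as _ ⟩
        viaSpine as ++ dartLoop l ++ dartLoop (linv l) ++ viaSpine bs     ≡⟨ cong (viaSpine as ++_) (++-assoc (dartLoop l) _ _) ⟨
        viaSpine as ++ (dartLoop l ++ dartLoop (linv l)) ++ viaSpine bs   ≈⟨ ≃-congˡ (viaSpine as) (≃-congʳ (viaSpine bs) (dartLoop-inverse l)) ⟩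
        viaSpine as ++ viaSpine bs                                        ≡⟨ viaSpine-++ as bs ⟨
        viaSpine (as ++ bs)                                               ∎)
      where open ≃-Reasoning
    step (relator as ρ bs ρ∈) = begin
        viaSpine (as ++ ρ ++ bs)                   ≡⟨ trans (viaSpine-++ as _) (cong (viaSpine as ++_) (viaSpine-++ ρ bs)) ⟩
        viaSpine as ++ viaSpine ρ ++ viaSpine bs   ≈⟨ ≋-congˡ (viaSpine-closed as) (≋-congʳ (viaSpine bs) (viaSpine-relator ρ∈)) ⟩
        viaSpine as ++ viaSpine bs                 ≡⟨ viaSpine-++ as bs ⟨
        viaSpine (as ++ bs)                        ∎
      where open ≋-Reasoning

  closed-≈⇒≋ : ∀ {u v} → IsWalk G x₀ x₀ u → IsWalk G x₀ x₀ v → u ≈ v → u ≋ v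
  closed-≈⇒≋ {u} {v} u-closed v-closed u≈v = begin
      u              ≈⟨ ≃⇒≋ (viaSpine-≃ u-closed) ⟨
      viaSpine u     ≈⟨ ≈⇒viaSpine-≋ u≈v ⟩
      viaSpine v     ≈⟨ ≃⇒≋ (viaSpine-≃ v-closed) ⟩
      v              ∎
    where open ≋-Reasoning

  deckFinitelyPresented : DeckFinitelyPresented G x₀ r
  deckFinitelyPresented = Graph.nE G , relators , deckWord , wellDefined , injective , surjective , multiplicative
    where
    open Cover G x₀ r

    wellDefined : ∀ f g → f ≈D g → deckWord f ≈ deckWord g
    wellDefined f g f≈g = ≋⇒≈ (≈D⇒deckWord-≋ f g f≈g)

    injective : ∀ f g → deckWord f ≈ deckWord g → f ≈D g
    injective f g f≈g = deckWord-≋⇒≈D f g (closed-≈⇒≋ (deckWord-closed f) (deckWord-closed g) f≈g)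

    surjective : ∀ w → Σ Deck λ f → deckWord f ≈ w
    surjective w = translation (viaSpine-closed w) , ≈-trans (≡⇒≈ (deckWord-translation (viaSpine-closed w))) (viaSpine-≈ w)

    multiplicative : ∀ h f g → IsComposite h f g → deckWord h ≈ deckWord f ++ deckWord g
    multiplicative h f g h≡fg = ≋⇒≈ (deckWord-composite h f g h≡fg)

proposition4p8 : (G : Graph) → Connected G → (x₀ : V G) → (r : ℕ) → DeckFinitelyPresented G x₀ r
proposition4p8 G connected x₀ r = DeckPresentation.deckFinitelyPresented G connected x₀ r
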